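{- Let $t,s,c,\sigma,\gamma$ be positive integers and $S=\{1,\ldots,s\}$. The linear program $$\min\ \frac{1}{t}\sum_{i\in S}\sum_{j=1}^{\sigma}\frac{1}{j}x_{i,j}\quad\text{s.t.}\quad \sum_{j=1}^{\sigma}x_{i,j}\geq\left\lceil\frac{c}{\gamma}\right\rceil\ (i\in S),\quad \sum_{j=1}^{\sigma}(j-1)x_{i,j}\leq s-1\ (i\in S),\quad x_{i,j}\in\mathbb{R}_+\ (i\in S,\ j\in\{1,\ldots,\sigma\})$$ has optimal value $$\frac{s}{t}\max\left(\frac{1}{\sigma}\left\lceil\frac{c}{\gamma}\right\rceil,\max_{j\in\{2,\ldots,\sigma\}}\left(\frac 2 j \left\lceil\frac{c}{\gamma}\right\rceil-\frac{s-1}{j(j-1)}\right)\right),$$ where the inner maximum over the empty set (when $\sigma=1$) is omitted.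
   Formalization: The variables $x_{i,j}$ of the linear program range over the nonnegative rationals instead of $\mathbb{R}_+$. -}

module Defs where

open import Data.Nat using (ℕ; zero; suc; NonZero)
import Data.Nat as ℕ
open import Data.Integer using (ℤ; +_)
open import Data.Fin using (Fin; toℕ)
open import Data.Product using (Σ; _×_)
open import Data.Rational using (ℚ; 0ℚ; _+_; _*_; _-_; _⊔_; _≤_; _/_; ceiling)
open import Relation.Binary.PropositionalEquality using (_≡_)

ℕtoℚ : ℕ → ℚ
ℕtoℚ n = (+ n) / 1

sumFin : (n : ℕ) → (Fin n → ℚ) → ℚ
sumFin zero    f = 0ℚ
sumFin (suc n) f = f Fin.zero + sumFin n (λ i → f (Fin.suc i))
  where import Data.Fin as Fin

ceilCγ : (c γ : ℕ) → .{{_ : NonZero γ}} → ℚ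
ceilCγ c γ = (ceiling ((+ c) / γ)) / 1

-- Variables x_{i,j}, i ∈ S = {1..s} encoded as Fin s, j ∈ {1..σ} encoded
-- as Fin σ with index j' : Fin σ standing for j = toℕ j' + 1.
Var : ℕ → ℕ → Set
Var s σ = Fin s → Fin σ → ℚ

Feasible : (s c σ γ : ℕ) → .{{_ : NonZero γ}} → Var s σ → Set
Feasible s c σ γ x =
  (∀ i j → 0ℚ ≤ x i j)
  × (∀ i → ceilCγ c γ ≤ sumFin σ (λ j → x i j))
  × (∀ i → sumFin σ (λ j → ℕtoℚ (toℕ j) * x i j) ≤ ℕtoℚ (s ℕ.∸ 1))

objective : (t s σ : ℕ) → .{{_ : NonZero t}} → Var s σ → ℚ
objective t s σ x =
  ((+ 1) / t) * sumFin s (λ i → sumFin σ (λ j → ((+ 1) / suc (toℕ j)) * x i j))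

IsOptimalValue : (t s c σ γ : ℕ) → .{{_ : NonZero t}} → .{{_ : NonZero γ}} → ℚ → Set
IsOptimalValue t s c σ γ v =
  Σ (Var s σ) (λ x → Feasible s c σ γ x × objective t s σ x ≡ v)
  × (∀ (x : Var s σ) → Feasible s c σ γ x → v ≤ objective t s σ x)

-- term for j ≥ 2 :  (2/j) K - (s-1)/(j(j-1)), here j = k+2
term : (s : ℕ) → ℚ → ℕ → ℚ
term s K k = ((+ 2) / suc (suc k)) * K - (+ (s ℕ.∸ 1)) / (suc (suc k) ℕ.* suc k)

maxUpTo : (s : ℕ) → ℚ → ℚ → ℕ → ℚ
maxUpTo s K base zero = base
maxUpTo s K base (suc zero) = base
maxUpTo s K base (suc (suc k)) = maxUpTo s K base (suc k) ⊔ term s K k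

optValue : (t s c σ γ : ℕ) → .{{_ : NonZero t}} → .{{_ : NonZero σ}} → .{{_ : NonZero γ}} → ℚ
optValue t s c σ γ =
  ((+ s) / t) * maxUpTo s K (((+ 1) / σ) * K) σ
  where K = ceilCγ c γ

module Submission where

-- The constraints couple only the variables x_{i,·} of one row i, so the program splits into s copies
-- of the row problem  min Σⱼ yⱼ/j  subject to  Σⱼ yⱼ ≥ K,  Σⱼ (j−1) yⱼ ≤ s−1,  y ≥ 0,  where K = ⌈c/γ⌉.
-- Lower bound: weak duality with the dual points (1/σ, 0) and (2/j, 1/(j(j−1))), 2 ≤ j ≤ σ; the
-- latter is feasible because (j−1−u)(j−u) ≥ 0 for all integers j, u.  Upper bound: if (σ−1)K ≤ s−1
-- all of K goes on j = σ; otherwise s−1 = qK + r with 0 ≤ r < K, and K−r on j = q+1 together with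
-- r on j = q+2 meets the second constraint with equality and costs exactly the term for j = q+2.
-- Every rational identity is reduced to one between naturals by cross-multiplying fractions.

open import Data.Empty using (⊥-elim)
open import Data.Fin using (Fin; toℕ) renaming (zero to fzero; suc to fsuc)
import Data.Fin.Properties as Fin
open import Data.Integer as ℤ using (+_)
import Data.Integer.Properties as ℤ
open import Data.Nat as ℕ using (ℕ; zero; suc; NonZero; z≤n; s≤s)
import Data.Nat.DivMod as ℕ
import Data.Nat.Properties as ℕ
import Data.Nat.Tactic.RingSolver as ℕ-Solver
open import Data.Product using (Σ; ∃; _×_; _,_)
open import Data.Rational
  using (ℚ; mkℚ; 0ℚ; 1ℚ; _+_; _*_; _-_; -_; _≤_; _/_; fromℚᵘ; ceiling; NonNegative; nonNegative)
open import Data.Rational.Properties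
open import Data.Rational.Unnormalised as ℚᵘ using (mkℚᵘ; *≡*; *≤*)
import Data.Rational.Unnormalised.Properties as ℚᵘ
open import Data.Sum using (_⊎_; inj₁; inj₂)
open import Level using (0ℓ)
open import Relation.Binary.PropositionalEquality
open import Relation.Nullary.Decidable using (yes; no; dec⇒maybe)
import Tactic.RingSolver as RingSolver
import Tactic.RingSolver.Core.AlmostCommutativeRing as ACR

open import Defs

ℚ-ring : ACR.AlmostCommutativeRing 0ℓ 0ℓ
ℚ-ring = ACR.fromCommutativeRing +-*-commutativeRing (λ p → dec⇒maybe (0ℚ ≟ p))

open RingSolver using (solve-∀)

fromℚᵘ-homo-+ : ∀ p q → fromℚᵘ (p ℚᵘ.+ q) ≡ fromℚᵘ p + fromℚᵘ q
fromℚᵘ-homo-+ p q = toℚᵘ-injective (ℚᵘ.≃-trans (toℚᵘ-fromℚᵘ (p ℚᵘ.+ q)) (ℚᵘ.≃-sym (ℚᵘ.≃-trans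
  (toℚᵘ-homo-+ (fromℚᵘ p) (fromℚᵘ q)) (ℚᵘ.+-cong (toℚᵘ-fromℚᵘ p) (toℚᵘ-fromℚᵘ q)))))

fromℚᵘ-homo-* : ∀ p q → fromℚᵘ (p ℚᵘ.* q) ≡ fromℚᵘ p * fromℚᵘ q
fromℚᵘ-homo-* p q = toℚᵘ-injective (ℚᵘ.≃-trans (toℚᵘ-fromℚᵘ (p ℚᵘ.* q)) (ℚᵘ.≃-sym (ℚᵘ.≃-trans
  (toℚᵘ-homo-* (fromℚᵘ p) (fromℚᵘ q)) (ℚᵘ.*-cong (toℚᵘ-fromℚᵘ p) (toℚᵘ-fromℚᵘ q)))))

fromℚᵘ-mono-≤ : ∀ {p q} → p ℚᵘ.≤ q → fromℚᵘ p ≤ fromℚᵘ q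
fromℚᵘ-mono-≤ {p} {q} p≤q = toℚᵘ-cancel-≤
  (ℚᵘ.≤-respˡ-≃ (ℚᵘ.≃-sym (toℚᵘ-fromℚᵘ p)) (ℚᵘ.≤-respʳ-≃ (ℚᵘ.≃-sym (toℚᵘ-fromℚᵘ q)) p≤q))

/-cross-≡ : ∀ a b c d .{{_ : NonZero c}} .{{_ : NonZero d}} →
            a ℕ.* d ≡ b ℕ.* c → (+ a) / c ≡ (+ b) / d
/-cross-≡ a b (suc c) (suc d) eq = fromℚᵘ-cong {mkℚᵘ (+ a) c} {mkℚᵘ (+ b) d} (*≡* (begin
  + a ℤ.* + suc d  ≡⟨ ℤ.pos-* a (suc d) ⟨
  + (a ℕ.* suc d)  ≡⟨ cong +_ eq ⟩
  + (b ℕ.* suc c)  ≡⟨ ℤ.pos-* b (suc c) ⟩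
  + b ℤ.* + suc c  ∎))
  where open ≡-Reasoning

/-cross-≤ : ∀ a b c d .{{_ : NonZero c}} .{{_ : NonZero d}} →
            a ℕ.* d ℕ.≤ b ℕ.* c → (+ a) / c ≤ (+ b) / d
/-cross-≤ a b (suc c) (suc d) le = fromℚᵘ-mono-≤ {mkℚᵘ (+ a) c} {mkℚᵘ (+ b) d}
  (*≤* (subst₂ ℤ._≤_ (ℤ.pos-* a (suc d)) (ℤ.pos-* b (suc c)) (ℤ.+≤+ le)))

/-+ : ∀ a b c d .{{_ : NonZero c}} .{{_ : NonZero d}} →
      (+ a) / c + (+ b) / d ≡ _/_ (+ (a ℕ.* d ℕ.+ b ℕ.* c)) (c ℕ.* d) {{ℕ.m*n≢0 c d}}
/-+ a b (suc c) (suc d) = begin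
  (+ a) / suc c + (+ b) / suc d
    ≡⟨ fromℚᵘ-homo-+ (mkℚᵘ (+ a) c) (mkℚᵘ (+ b) d) ⟨
  (+ a ℤ.* + suc d ℤ.+ + b ℤ.* + suc c) / (suc c ℕ.* suc d)
    ≡⟨ /-cong (cong₂ ℤ._+_ (ℤ.pos-* a (suc d)) (ℤ.pos-* b (suc c))) refl ⟨
  (+ (a ℕ.* suc d) ℤ.+ + (b ℕ.* suc c)) / (suc c ℕ.* suc d)
    ≡⟨ /-cong (ℤ.pos-+ (a ℕ.* suc d) (b ℕ.* suc c)) refl ⟨
  (+ (a ℕ.* suc d ℕ.+ b ℕ.* suc c)) / (suc c ℕ.* suc d)  ∎
  where open ≡-Reasoning

/-* : ∀ a b c d .{{_ : NonZero c}} .{{_ : NonZero d}} →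
      (+ a) / c * ((+ b) / d) ≡ _/_ (+ (a ℕ.* b)) (c ℕ.* d) {{ℕ.m*n≢0 c d}}
/-* a b (suc c) (suc d) =
  trans (sym (fromℚᵘ-homo-* (mkℚᵘ (+ a) c) (mkℚᵘ (+ b) d))) (/-cong (sym (ℤ.pos-* a b)) refl)

ℕtoℚ-*-/ : ∀ a b d .{{_ : NonZero d}} → ℕtoℚ a * ((+ b) / d) ≡ (+ (a ℕ.* b)) / d
ℕtoℚ-*-/ a b (suc d) = trans (/-* a b 1 (suc d)) (/-cong {+ (a ℕ.* b)} refl (ℕ.*-identityˡ (suc d)))

0≤/ : ∀ a c .{{_ : NonZero c}} → 0ℚ ≤ (+ a) / c
0≤/ a c = nonNegative⁻¹ _ {{normalize-nonNeg a c}}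

n/d≡n*[1/d] : ∀ n d .{{_ : NonZero d}} → (+ n) / d ≡ ℕtoℚ n * ((+ 1) / d)
n/d≡n*[1/d] n d = trans (/-cong (cong +_ (sym (ℕ.*-identityʳ n))) refl) (sym (ℕtoℚ-*-/ n 1 d))

ℕtoℚ-+ : ∀ a b → ℕtoℚ (a ℕ.+ b) ≡ ℕtoℚ a + ℕtoℚ b
ℕtoℚ-+ a b = sym (trans (/-+ a b 1 1)
  (/-cong (cong₂ (λ x y → + (x ℕ.+ y)) (ℕ.*-identityʳ a) (ℕ.*-identityʳ b)) refl))

ℕtoℚ-mono-≤ : ∀ {a b} → a ℕ.≤ b → ℕtoℚ a ≤ ℕtoℚ b
ℕtoℚ-mono-≤ {a} {b} a≤b = /-cross-≤ a b 1 1 (ℕ.*-monoˡ-≤ 1 a≤b)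

sumFin-cong : ∀ n {f g : Fin n → ℚ} → (∀ j → f j ≡ g j) → sumFin n f ≡ sumFin n g
sumFin-cong zero    f≗g = refl
sumFin-cong (suc n) f≗g = cong₂ _+_ (f≗g fzero) (sumFin-cong n (λ j → f≗g (fsuc j)))

sumFin-mono-≤ : ∀ n {f g : Fin n → ℚ} → (∀ j → f j ≤ g j) → sumFin n f ≤ sumFin n g
sumFin-mono-≤ zero    f≤g = ≤-refl
sumFin-mono-≤ (suc n) f≤g = +-mono-≤ (f≤g fzero) (sumFin-mono-≤ n (λ j → f≤g (fsuc j)))

sumFin-linear : ∀ n a b (f g : Fin n → ℚ) →
                sumFin n (λ j → a * f j + b * g j) ≡ a * sumFin n f + b * sumFin n g
sumFin-linear zero    a b f g = sym (trans (cong₂ _+_ (*-zeroʳ a) (*-zeroʳ b)) (+-identityʳ 0ℚ))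
sumFin-linear (suc n) a b f g = begin
  (a * f fzero + b * g fzero) + sumFin n (λ j → a * f (fsuc j) + b * g (fsuc j))
    ≡⟨ cong (_+_ (a * f fzero + b * g fzero)) (sumFin-linear n a b (λ j → f (fsuc j)) (λ j → g (fsuc j))) ⟩
  (a * f fzero + b * g fzero) + (a * F + b * G)
    ≡⟨ regroup a b (f fzero) (g fzero) F G ⟩
  a * (f fzero + F) + b * (g fzero + G)  ∎
  where
  open ≡-Reasoning
  regroup : ∀ a b x y X Y → (a * x + b * y) + (a * X + b * Y) ≡ a * (x + X) + b * (y + Y)
  regroup = solve-∀ ℚ-ring
  F = sumFin n (λ j → f (fsuc j))
  G = sumFin n (λ j → g (fsuc j))

sumFin-const : ∀ n r → sumFin n (λ _ → r) ≡ ℕtoℚ n * r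
sumFin-const zero    r = sym (*-zeroˡ r)
sumFin-const (suc n) r = begin
  r + sumFin n (λ _ → r)  ≡⟨ cong (_+_ r) (sumFin-const n r) ⟩
  r + ℕtoℚ n * r          ≡⟨ cong (_+ ℕtoℚ n * r) (*-identityˡ r) ⟨
  1ℚ * r + ℕtoℚ n * r     ≡⟨ *-distribʳ-+ r 1ℚ (ℕtoℚ n) ⟨
  (1ℚ + ℕtoℚ n) * r       ≡⟨ cong (_* r) (ℕtoℚ-+ 1 n) ⟨
  ℕtoℚ (suc n) * r        ∎
  where open ≡-Reasoning

δ : ℕ → ℕ → ℚ
δ zero    zero    = 1ℚ
δ zero    (suc p) = 0ℚ
δ (suc q) zero    = 0ℚ
δ (suc q) (suc p) = δ q p

0≤δ : ∀ q p → 0ℚ ≤ δ q p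
0≤δ zero    zero    = 0≤/ 1 1
0≤δ zero    (suc p) = ≤-refl
0≤δ (suc q) zero    = ≤-refl
0≤δ (suc q) (suc p) = 0≤δ q p

sumFin-δ : ∀ n q (w : ℕ → ℚ) → q ℕ.< n → sumFin n (λ j → w (toℕ j) * δ q (toℕ j)) ≡ w q
sumFin-δ (suc n) zero w _ = begin
  w 0 * 1ℚ + sumFin n (λ j → w (suc (toℕ j)) * 0ℚ)
    ≡⟨ cong₂ _+_ (*-identityʳ (w 0)) (sumFin-cong n (λ j → *-zeroʳ (w (suc (toℕ j))))) ⟩
  w 0 + sumFin n (λ _ → 0ℚ)
    ≡⟨ cong (_+_ (w 0)) (trans (sumFin-const n 0ℚ) (*-zeroʳ (ℕtoℚ n))) ⟩
  w 0 + 0ℚ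
    ≡⟨ +-identityʳ (w 0) ⟩
  w 0  ∎
  where open ≡-Reasoning
sumFin-δ (suc n) (suc q) w (s≤s q<n) =
  trans (cong₂ _+_ (*-zeroʳ (w 0)) (sumFin-δ n q (λ p → w (suc p)) q<n)) (+-identityˡ (w (suc q)))

twoPoint : ℕ → ℚ → ℚ → ℕ → ℚ
twoPoint q A B p = A * δ q p + B * δ (suc q) p

0≤twoPoint : ∀ q {A B} → 0ℚ ≤ A → 0ℚ ≤ B → ∀ p → 0ℚ ≤ twoPoint q A B p
0≤twoPoint q {A} {B} 0≤A 0≤B p = +-mono-≤ (0≤* 0≤A (0≤δ q p)) (0≤* 0≤B (0≤δ (suc q) p))
  where
  0≤* : ∀ {a b} → 0ℚ ≤ a → 0ℚ ≤ b → 0ℚ ≤ a * b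
  0≤* {a} {b} 0≤a 0≤b =
    nonNegative⁻¹ (a * b) {{nonNeg*nonNeg⇒nonNeg a {{nonNegative 0≤a}} b {{nonNegative 0≤b}}}}

sumFin-twoPoint : ∀ n q A B (w : ℕ → ℚ) → q ℕ.< n → suc q ℕ.< n ⊎ B ≡ 0ℚ →
                  sumFin n (λ j → w (toℕ j) * twoPoint q A B (toℕ j)) ≡ A * w q + B * w (suc q)
sumFin-twoPoint n q A B w q<n second = begin
  sumFin n (λ j → w (toℕ j) * twoPoint q A B (toℕ j))
    ≡⟨ sumFin-cong n (λ j → distribute A B (w (toℕ j)) (δ q (toℕ j)) (δ (suc q) (toℕ j))) ⟩
  sumFin n (λ j → A * (w (toℕ j) * δ q (toℕ j)) + B * (w (toℕ j) * δ (suc q) (toℕ j)))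
    ≡⟨ sumFin-linear n A B _ _ ⟩
  A * sumFin n (λ j → w (toℕ j) * δ q (toℕ j)) + B * sumFin n (λ j → w (toℕ j) * δ (suc q) (toℕ j))
    ≡⟨ cong₂ _+_ (cong (A *_) (sumFin-δ n q w q<n)) (second-mass second) ⟩
  A * w q + B * w (suc q)  ∎
  where
  open ≡-Reasoning
  distribute : ∀ A B w d d′ → w * (A * d + B * d′) ≡ A * (w * d) + B * (w * d′)
  distribute = solve-∀ ℚ-ring
  second-mass : suc q ℕ.< n ⊎ B ≡ 0ℚ → B * sumFin n (λ j → w (toℕ j) * δ (suc q) (toℕ j)) ≡ B * w (suc q)
  second-mass (inj₁ 1+q<n) = cong (B *_) (sumFin-δ n (suc q) w 1+q<n)
  second-mass (inj₂ refl)  =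
    trans (*-zeroˡ (sumFin n (λ j → w (toℕ j) * δ (suc q) (toℕ j)))) (sym (*-zeroˡ (w (suc q))))

sumFin-twoPoint-mass : ∀ n q A B → q ℕ.< n → suc q ℕ.< n ⊎ B ≡ 0ℚ →
                       sumFin n (λ j → twoPoint q A B (toℕ j)) ≡ A + B
sumFin-twoPoint-mass n q A B q<n second = begin
  sumFin n (λ j → twoPoint q A B (toℕ j))       ≡⟨ sumFin-cong n (λ j → *-identityˡ _) ⟨
  sumFin n (λ j → 1ℚ * twoPoint q A B (toℕ j))  ≡⟨ sumFin-twoPoint n q A B (λ _ → 1ℚ) q<n second ⟩
  A * 1ℚ + B * 1ℚ                               ≡⟨ cong₂ _+_ (*-identityʳ A) (*-identityʳ B) ⟩
  A + B                                         ∎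
  where open ≡-Reasoning

-- The row problem: lower bound by weak duality

rowCost : (σ : ℕ) → (Fin σ → ℚ) → ℚ
rowCost σ y = sumFin σ (λ j → ((+ 1) / suc (toℕ j)) * y j)

RowFeasible : (σ : ℕ) (K m : ℚ) → (Fin σ → ℚ) → Set
RowFeasible σ K m y =
  (∀ j → 0ℚ ≤ y j) × (K ≤ sumFin σ y) × (sumFin σ (λ j → ℕtoℚ (toℕ j) * y j) ≤ m)

DualFeasible : (σ : ℕ) (a b : ℚ) → Set
DualFeasible σ a b = (0ℚ ≤ a) × (0ℚ ≤ b) × (∀ p → p ℕ.< σ → a ≤ (+ 1) / suc p + ℕtoℚ p * b)

weak-duality : ∀ {σ K m a b} {y : Fin σ → ℚ} →
               DualFeasible σ a b → RowFeasible σ K m y → a * K - b * m ≤ rowCost σ y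
weak-duality {σ} {K} {m} {a} {b} {y} (0≤a , 0≤b , dual) (0≤y , K≤Σy , Σpy≤m) = begin
  a * K - b * m
    ≤⟨ +-mono-≤ (*-monoˡ-≤-nonNeg a {{nonNegative 0≤a}} K≤Σy)
                (neg-antimono-≤ (*-monoˡ-≤-nonNeg b {{nonNegative 0≤b}} Σpy≤m)) ⟩
  a * sumFin σ y - b * sumFin σ py
    ≡⟨ cong (_+_ (a * sumFin σ y)) (neg-distribˡ-* b (sumFin σ py)) ⟩
  a * sumFin σ y + (- b) * sumFin σ py
    ≡⟨ sumFin-linear σ a (- b) y py ⟨
  sumFin σ (λ j → a * y j + (- b) * py j)
    ≤⟨ sumFin-mono-≤ σ termwise ⟩
  rowCost σ y  ∎
  where
  open ≤-Reasoning
  py : Fin σ → ℚ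
  py j = ℕtoℚ (toℕ j) * y j
  cancel : ∀ a h p b y → (h + p * b) * y + (- b) * (p * y) ≡ h * y
  cancel = solve-∀ ℚ-ring
  termwise : ∀ j → a * y j + (- b) * py j ≤ ((+ 1) / suc (toℕ j)) * y j
  termwise j = begin
    a * y j + (- b) * py j
      ≤⟨ +-monoˡ-≤ _ (*-monoʳ-≤-nonNeg (y j) {{nonNegative (0≤y j)}} (dual (toℕ j) (Fin.toℕ<n j))) ⟩
    ((+ 1) / suc (toℕ j) + ℕtoℚ (toℕ j) * b) * y j + (- b) * py j
      ≡⟨ cancel a ((+ 1) / suc (toℕ j)) (ℕtoℚ (toℕ j)) b (y j) ⟩
    ((+ 1) / suc (toℕ j)) * y j  ∎

-- With j = k + 2 and u = p + 1 the surplus is (j − 1 − u)(j − u), a product of consecutive integers.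
2[1+k][1+p]≤[2+k][1+k]+p[1+p] : ∀ k p → 2 ℕ.* suc k ℕ.* suc p ℕ.≤ suc (suc k) ℕ.* suc k ℕ.+ p ℕ.* suc p
2[1+k][1+p]≤[2+k][1+k]+p[1+p] k p with ℕ.≤-<-connex p k
... | inj₁ p≤k with (e , refl) ← ℕ.m≤n⇒∃[o]m+o≡n p≤k =
  ℕ.≤-trans (ℕ.m≤m+n _ (e ℕ.* suc e)) (ℕ.≤-reflexive (surplus p e))
  where
  surplus : ∀ p e → 2 ℕ.* suc (p ℕ.+ e) ℕ.* suc p ℕ.+ e ℕ.* suc e
                  ≡ suc (suc (p ℕ.+ e)) ℕ.* suc (p ℕ.+ e) ℕ.+ p ℕ.* suc p
  surplus = ℕ-Solver.solve-∀
... | inj₂ k<p with (e , refl) ← ℕ.m≤n⇒∃[o]m+o≡n k<p =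
  ℕ.≤-trans (ℕ.m≤m+n _ (e ℕ.* suc e)) (ℕ.≤-reflexive (surplus k e))
  where
  surplus : ∀ k e → 2 ℕ.* suc k ℕ.* suc (suc k ℕ.+ e) ℕ.+ e ℕ.* suc e
                  ≡ suc (suc k) ℕ.* suc k ℕ.+ (suc k ℕ.+ e) ℕ.* suc (suc k ℕ.+ e)
  surplus = ℕ-Solver.solve-∀

dualFeasible-base : ∀ σ' → DualFeasible (suc σ') ((+ 1) / suc σ') 0ℚ
dualFeasible-base σ' = 0≤/ 1 (suc σ') , ≤-refl , λ p p<σ → begin
  (+ 1) / suc σ'                ≤⟨ /-cross-≤ 1 1 (suc σ') (suc p) (ℕ.*-monoʳ-≤ 1 p<σ) ⟩
  (+ 1) / suc p                 ≡⟨ +-identityʳ _ ⟨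
  (+ 1) / suc p + 0ℚ            ≡⟨ cong (_+_ ((+ 1) / suc p)) (*-zeroʳ (ℕtoℚ p)) ⟨
  (+ 1) / suc p + ℕtoℚ p * 0ℚ  ∎
  where open ≤-Reasoning

dualFeasible-term : ∀ σ k → DualFeasible σ ((+ 2) / suc (suc k)) ((+ 1) / (suc (suc k) ℕ.* suc k))
dualFeasible-term σ k = 0≤/ 2 (suc (suc k)) , 0≤/ 1 D , λ p _ → begin
  (+ 2) / suc (suc k)
    ≤⟨ /-cross-≤ 2 (1 ℕ.* D ℕ.+ p ℕ.* 1 ℕ.* suc p) (suc (suc k)) (suc p ℕ.* D) (cleared p) ⟩
  (+ (1 ℕ.* D ℕ.+ p ℕ.* 1 ℕ.* suc p)) / (suc p ℕ.* D)
    ≡⟨ /-+ 1 (p ℕ.* 1) (suc p) D ⟨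
  (+ 1) / suc p + (+ (p ℕ.* 1)) / D
    ≡⟨ cong (_+_ ((+ 1) / suc p)) (ℕtoℚ-*-/ p 1 D) ⟨
  (+ 1) / suc p + ℕtoℚ p * ((+ 1) / D)  ∎
  where
  open ≤-Reasoning
  D = suc (suc k) ℕ.* suc k
  lhs : ∀ k p → 2 ℕ.* suc k ℕ.* suc p ℕ.* suc (suc k) ≡ 2 ℕ.* (suc p ℕ.* (suc (suc k) ℕ.* suc k))
  lhs = ℕ-Solver.solve-∀
  rhs : ∀ k p → (suc (suc k) ℕ.* suc k ℕ.+ p ℕ.* suc p) ℕ.* suc (suc k)
              ≡ (1 ℕ.* (suc (suc k) ℕ.* suc k) ℕ.+ p ℕ.* 1 ℕ.* suc p) ℕ.* suc (suc k)
  rhs = ℕ-Solver.solve-∀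
  cleared : ∀ p → 2 ℕ.* (suc p ℕ.* D) ℕ.≤ (1 ℕ.* D ℕ.+ p ℕ.* 1 ℕ.* suc p) ℕ.* suc (suc k)
  cleared p = subst₂ ℕ._≤_ (lhs k p) (rhs k p)
    (ℕ.*-monoˡ-≤ (suc (suc k)) (2[1+k][1+p]≤[2+k][1+k]+p[1+p] k p))

term≡dualObjective : ∀ s K k →
  term s K k ≡ (+ 2) / suc (suc k) * K - (+ 1) / (suc (suc k) ℕ.* suc k) * ℕtoℚ (s ℕ.∸ 1)
term≡dualObjective s K k = cong (λ z → (+ 2) / suc (suc k) * K - z)
  (trans (n/d≡n*[1/d] (s ℕ.∸ 1) (suc (suc k) ℕ.* suc k)) (*-comm (ℕtoℚ (s ℕ.∸ 1)) _))

maxUpTo-lub : ∀ s K base n {r} → base ≤ r → (∀ k → suc (suc k) ℕ.≤ n → term s K k ≤ r) →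
              maxUpTo s K base n ≤ r
maxUpTo-lub s K base zero          base≤r _     = base≤r
maxUpTo-lub s K base (suc zero)    base≤r _     = base≤r
maxUpTo-lub s K base (suc (suc n)) base≤r term≤r = ⊔-lub
  (maxUpTo-lub s K base (suc n) base≤r (λ k k≤n → term≤r k (ℕ.m≤n⇒m≤1+n k≤n)))
  (term≤r n ℕ.≤-refl)

base≤maxUpTo : ∀ s K base n → base ≤ maxUpTo s K base n
base≤maxUpTo s K base zero          = ≤-refl
base≤maxUpTo s K base (suc zero)    = ≤-refl
base≤maxUpTo s K base (suc (suc n)) = p≤q⇒p≤q⊔r (term s K n) (base≤maxUpTo s K base (suc n))

term≤maxUpTo : ∀ s K base {k n} → suc (suc k) ℕ.≤′ n → term s K k ≤ maxUpTo s K base n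
term≤maxUpTo s K base {k} ℕ.≤′-refl = p≤q⊔p (maxUpTo s K base (suc k)) (term s K k)
term≤maxUpTo s K base {k} (ℕ.≤′-step ℕ.≤′-refl) =
  p≤q⇒p≤q⊔r (term s K (suc k)) (term≤maxUpTo s K base {k} ℕ.≤′-refl)
term≤maxUpTo s K base {k} (ℕ.≤′-step {suc n} (ℕ.≤′-step k≤n)) =
  p≤q⇒p≤q⊔r (term s K n) (term≤maxUpTo s K base {k} (ℕ.≤′-step k≤n))

rowValue : (s σ' : ℕ) → ℚ → ℚ
rowValue s σ' K = maxUpTo s K ((+ 1) / suc σ' * K) (suc σ')

rowValue≤rowCost : ∀ s σ' K {y} → RowFeasible (suc σ') K (ℕtoℚ (s ℕ.∸ 1)) y →
                   rowValue s σ' K ≤ rowCost (suc σ') y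
rowValue≤rowCost s σ' K y-feasible = maxUpTo-lub s K _ (suc σ')
  (≤-trans (≤-reflexive (sym (dual-value ((+ 1) / suc σ') K (ℕtoℚ (s ℕ.∸ 1)))))
           (weak-duality (dualFeasible-base σ') y-feasible))
  (λ k _ → ≤-trans (≤-reflexive (term≡dualObjective s K k))
                   (weak-duality (dualFeasible-term (suc σ') k) y-feasible))
  where
  dual-value : ∀ a K m → a * K - 0ℚ * m ≡ a * K
  dual-value = solve-∀ ℚ-ring

-- The row problem: attaining the bound

RowSolution : (s σ' k : ℕ) → Set
RowSolution s σ' k = Σ (Fin (suc σ') → ℚ) λ y →
  RowFeasible (suc σ') (ℕtoℚ k) (ℕtoℚ (s ℕ.∸ 1)) y × rowCost (suc σ') y ≤ rowValue s σ' (ℕtoℚ k)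

pointMass-solution : ∀ s σ' k → σ' ℕ.* k ℕ.≤ s ℕ.∸ 1 → RowSolution s σ' k
pointMass-solution s σ' k σ'k≤m = y , (0≤y , K≤Σy , Σpy≤m) , cost≤value
  where
  open ≤-Reasoning
  K = ℕtoℚ k
  y : Fin (suc σ') → ℚ
  y j = twoPoint σ' K 0ℚ (toℕ j)
  last : σ' ℕ.< suc σ'
  last = ℕ.n<1+n σ'
  massless : suc σ' ℕ.< suc σ' ⊎ 0ℚ ≡ 0ℚ
  massless = inj₂ refl
  only-first : ∀ A w w′ → A * w + 0ℚ * w′ ≡ w * A
  only-first = solve-∀ ℚ-ring
  0≤y : ∀ j → 0ℚ ≤ y j
  0≤y j = 0≤twoPoint σ' (0≤/ k 1) ≤-refl (toℕ j)
  K≤Σy : K ≤ sumFin (suc σ') y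
  K≤Σy = ≤-reflexive (sym (trans (sumFin-twoPoint-mass (suc σ') σ' K 0ℚ last massless) (+-identityʳ K)))
  Σpy≤m : sumFin (suc σ') (λ j → ℕtoℚ (toℕ j) * y j) ≤ ℕtoℚ (s ℕ.∸ 1)
  Σpy≤m = begin
    sumFin (suc σ') (λ j → ℕtoℚ (toℕ j) * y j)  ≡⟨ sumFin-twoPoint (suc σ') σ' K 0ℚ ℕtoℚ last massless ⟩
    K * ℕtoℚ σ' + 0ℚ * ℕtoℚ (suc σ')            ≡⟨ only-first K (ℕtoℚ σ') (ℕtoℚ (suc σ')) ⟩
    ℕtoℚ σ' * K                                  ≡⟨ ℕtoℚ-*-/ σ' k 1 ⟩
    ℕtoℚ (σ' ℕ.* k)                              ≤⟨ ℕtoℚ-mono-≤ σ'k≤m ⟩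
    ℕtoℚ (s ℕ.∸ 1)                               ∎
  cost≤value : rowCost (suc σ') y ≤ rowValue s σ' K
  cost≤value = begin
    rowCost (suc σ') y
      ≡⟨ sumFin-twoPoint (suc σ') σ' K 0ℚ (λ p → (+ 1) / suc p) last massless ⟩
    K * ((+ 1) / suc σ') + 0ℚ * ((+ 1) / suc (suc σ'))
      ≡⟨ only-first K ((+ 1) / suc σ') ((+ 1) / suc (suc σ')) ⟩
    (+ 1) / suc σ' * K
      ≤⟨ base≤maxUpTo s K _ (suc σ') ⟩
    rowValue s σ' K  ∎

twoPoint-cost≡term : ∀ s q a b → s ℕ.∸ 1 ≡ a ℕ.* q ℕ.+ b ℕ.* suc q →
  ℕtoℚ a * ((+ 1) / suc q) + ℕtoℚ b * ((+ 1) / suc (suc q)) ≡ term s (ℕtoℚ (a ℕ.+ b)) q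
twoPoint-cost≡term s q a b m≡ = begin
  cost                 ≡⟨ add-sub cost M ⟩
  cost + M - M         ≡⟨ cong (_- M) cost+M≡ ⟩
  term s (ℕtoℚ (a ℕ.+ b)) q  ∎
  where
  open ≡-Reasoning
  D  = suc (suc q) ℕ.* suc q
  E  = suc q ℕ.* suc (suc q)
  N  = a ℕ.* 1 ℕ.* suc (suc q) ℕ.+ b ℕ.* 1 ℕ.* suc q
  m  = a ℕ.* q ℕ.+ b ℕ.* suc q
  cost = ℕtoℚ a * ((+ 1) / suc q) + ℕtoℚ b * ((+ 1) / suc (suc q))
  M = (+ (s ℕ.∸ 1)) / D
  add-sub : ∀ x y → x ≡ x + y - y
  add-sub = solve-∀ ℚ-ring
  cleared : ∀ a b q → (  (a ℕ.* 1 ℕ.* suc (suc q) ℕ.+ b ℕ.* 1 ℕ.* suc q) ℕ.* (suc (suc q) ℕ.* suc q)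
                        ℕ.+ (a ℕ.* q ℕ.+ b ℕ.* suc q) ℕ.* (suc q ℕ.* suc (suc q))) ℕ.* (suc (suc q) ℕ.* 1)
                     ≡ 2 ℕ.* (a ℕ.+ b) ℕ.* ((suc q ℕ.* suc (suc q)) ℕ.* (suc (suc q) ℕ.* suc q))
  cleared = ℕ-Solver.solve-∀
  cost+M≡ : cost + M ≡ (+ 2) / suc (suc q) * ℕtoℚ (a ℕ.+ b)
  cost+M≡ = begin
    cost + M
      ≡⟨ cong₂ _+_ (cong₂ _+_ (ℕtoℚ-*-/ a 1 (suc q)) (ℕtoℚ-*-/ b 1 (suc (suc q))))
                   (cong (λ n → (+ n) / D) m≡) ⟩
    ((+ (a ℕ.* 1)) / suc q + (+ (b ℕ.* 1)) / suc (suc q)) + (+ m) / D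
      ≡⟨ cong (_+ (+ m) / D) (/-+ (a ℕ.* 1) (b ℕ.* 1) (suc q) (suc (suc q))) ⟩
    (+ N) / E + (+ m) / D
      ≡⟨ /-+ N m E D ⟩
    (+ (N ℕ.* D ℕ.+ m ℕ.* E)) / (E ℕ.* D)
      ≡⟨ /-cross-≡ (N ℕ.* D ℕ.+ m ℕ.* E) (2 ℕ.* (a ℕ.+ b)) (E ℕ.* D) (suc (suc q) ℕ.* 1) (cleared a b q) ⟩
    (+ (2 ℕ.* (a ℕ.+ b))) / (suc (suc q) ℕ.* 1)
      ≡⟨ /-* 2 (a ℕ.+ b) (suc (suc q)) 1 ⟨
    (+ 2) / suc (suc q) * ℕtoℚ (a ℕ.+ b)  ∎

twoPoint-solution : ∀ s σ' k .{{_ : NonZero k}} → s ℕ.∸ 1 ℕ.< σ' ℕ.* k → RowSolution s σ' k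
twoPoint-solution s σ' k m<σ'k = y , (0≤y , K≤Σy , Σpy≤m) , cost≤value
  where
  m = s ℕ.∸ 1
  q = m ℕ./ k
  r = m ℕ.% k
  a = k ℕ.∸ r
  K = ℕtoℚ k
  a+r≡k : a ℕ.+ r ≡ k
  a+r≡k = ℕ.m∸n+n≡m (ℕ.<⇒≤ (ℕ.m%n<n m k))
  regroup : ∀ a r q → r ℕ.+ q ℕ.* (a ℕ.+ r) ≡ a ℕ.* q ℕ.+ r ℕ.* suc q
  regroup = ℕ-Solver.solve-∀
  m≡ : m ≡ a ℕ.* q ℕ.+ r ℕ.* suc q
  m≡ = trans (ℕ.m≡m%n+[m/n]*n m k) (trans (cong (λ n → r ℕ.+ q ℕ.* n) (sym a+r≡k)) (regroup a r q))
  q<σ' : q ℕ.< σ'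
  q<σ' = ℕ.*-cancelʳ-< k q σ' (ℕ.≤-<-trans (ℕ.m/n*n≤m m k) m<σ'k)
  in-range : q ℕ.< suc σ'
  in-range = ℕ.m≤n⇒m≤1+n q<σ'
  second-in-range : suc q ℕ.< suc σ' ⊎ ℕtoℚ r ≡ 0ℚ
  second-in-range = inj₁ (s≤s q<σ')
  y : Fin (suc σ') → ℚ
  y j = twoPoint q (ℕtoℚ a) (ℕtoℚ r) (toℕ j)
  0≤y : ∀ j → 0ℚ ≤ y j
  0≤y j = 0≤twoPoint q (0≤/ a 1) (0≤/ r 1) (toℕ j)
  K≤Σy : K ≤ sumFin (suc σ') y
  K≤Σy = ≤-reflexive (begin
    K                       ≡⟨ cong ℕtoℚ a+r≡k ⟨
    ℕtoℚ (a ℕ.+ r)          ≡⟨ ℕtoℚ-+ a r ⟩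
    ℕtoℚ a + ℕtoℚ r         ≡⟨ sumFin-twoPoint-mass (suc σ') q (ℕtoℚ a) (ℕtoℚ r) in-range second-in-range ⟨
    sumFin (suc σ') y       ∎)
    where open ≡-Reasoning
  Σpy≤m : sumFin (suc σ') (λ j → ℕtoℚ (toℕ j) * y j) ≤ ℕtoℚ m
  Σpy≤m = ≤-reflexive (begin
    sumFin (suc σ') (λ j → ℕtoℚ (toℕ j) * y j)
      ≡⟨ sumFin-twoPoint (suc σ') q (ℕtoℚ a) (ℕtoℚ r) ℕtoℚ in-range second-in-range ⟩
    ℕtoℚ a * ℕtoℚ q + ℕtoℚ r * ℕtoℚ (suc q)
      ≡⟨ cong₂ _+_ (ℕtoℚ-*-/ a q 1) (ℕtoℚ-*-/ r (suc q) 1) ⟩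
    ℕtoℚ (a ℕ.* q) + ℕtoℚ (r ℕ.* suc q)
      ≡⟨ ℕtoℚ-+ (a ℕ.* q) (r ℕ.* suc q) ⟨
    ℕtoℚ (a ℕ.* q ℕ.+ r ℕ.* suc q)
      ≡⟨ cong ℕtoℚ m≡ ⟨
    ℕtoℚ m  ∎)
    where open ≡-Reasoning
  cost≤value : rowCost (suc σ') y ≤ rowValue s σ' K
  cost≤value = begin
    rowCost (suc σ') y
      ≡⟨ sumFin-twoPoint (suc σ') q (ℕtoℚ a) (ℕtoℚ r) (λ p → (+ 1) / suc p) in-range second-in-range ⟩
    ℕtoℚ a * ((+ 1) / suc q) + ℕtoℚ r * ((+ 1) / suc (suc q))
      ≡⟨ twoPoint-cost≡term s q a r m≡ ⟩
    term s (ℕtoℚ (a ℕ.+ r)) q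
      ≡⟨ cong (λ n → term s (ℕtoℚ n) q) a+r≡k ⟩
    term s K q
      ≤⟨ term≤maxUpTo s K _ (ℕ.≤⇒≤′ (s≤s q<σ')) ⟩
    rowValue s σ' K  ∎
    where open ≤-Reasoning

rowSolution : ∀ s σ' k → RowSolution s σ' k
rowSolution s σ' k with σ' ℕ.* k ℕ.≤? s ℕ.∸ 1
... | yes σ'k≤m = pointMass-solution s σ' k σ'k≤m
rowSolution s σ' zero    | no σ'k≰m = ⊥-elim (σ'k≰m (subst (ℕ._≤ s ℕ.∸ 1) (sym (ℕ.*-zeroʳ σ')) z≤n))
rowSolution s σ' (suc k) | no σ'k≰m = twoPoint-solution s σ' (suc k) (ℕ.≰⇒> σ'k≰m)

-- Feasible and IsOptimalValue with ⌈c/γ⌉ generalised to an arbitrary K.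
LPFeasible : (s σ : ℕ) → ℚ → Var s σ → Set
LPFeasible s σ K x =
  (∀ i j → 0ℚ ≤ x i j)
  × (∀ i → K ≤ sumFin σ (λ j → x i j))
  × (∀ i → sumFin σ (λ j → ℕtoℚ (toℕ j) * x i j) ≤ ℕtoℚ (s ℕ.∸ 1))

IsLPOptimum : (t s σ : ℕ) .{{_ : NonZero t}} → ℚ → ℚ → Set
IsLPOptimum t s σ K v =
  Σ (Var s σ) (λ x → LPFeasible s σ K x × objective t s σ x ≡ v)
  × (∀ x → LPFeasible s σ K x → v ≤ objective t s σ x)

lpOptimum : ∀ t s σ' k → IsLPOptimum (suc t) s (suc σ') (ℕtoℚ k) ((+ s) / suc t * rowValue s σ' (ℕtoℚ k))
lpOptimum t s σ' k with y , y-feasible , cost≤value ← rowSolution s σ' k =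
  (x* , x*-feasible , objective-x*) , value≤objective
  where
  K = ℕtoℚ k
  v = rowValue s σ' K
  cost-y≡v : rowCost (suc σ') y ≡ v
  cost-y≡v = ≤-antisym cost≤value (rowValue≤rowCost s σ' K y-feasible)
  x* : Var s (suc σ')
  x* _ = y
  x*-feasible : LPFeasible s (suc σ') K x*
  x*-feasible = let (0≤y , K≤Σy , Σpy≤m) = y-feasible in (λ _ → 0≤y) , (λ _ → K≤Σy) , (λ _ → Σpy≤m)
  1/t = (+ 1) / suc t
  rearrange : ∀ s u v → s * u * v ≡ u * (s * v)
  rearrange = solve-∀ ℚ-ring
  scale : (+ s) / suc t * v ≡ 1/t * sumFin s (λ _ → v)
  scale = begin
    (+ s) / suc t * v         ≡⟨ cong (_* v) (n/d≡n*[1/d] s (suc t)) ⟩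
    ℕtoℚ s * 1/t * v          ≡⟨ rearrange (ℕtoℚ s) 1/t v ⟩
    1/t * (ℕtoℚ s * v)        ≡⟨ cong (1/t *_) (sumFin-const s v) ⟨
    1/t * sumFin s (λ _ → v)  ∎
    where open ≡-Reasoning
  objective-x* : objective (suc t) s (suc σ') x* ≡ (+ s) / suc t * v
  objective-x* = trans (cong (1/t *_) (sumFin-cong s (λ _ → cost-y≡v))) (sym scale)
  value≤objective : ∀ x → LPFeasible s (suc σ') K x → (+ s) / suc t * v ≤ objective (suc t) s (suc σ') x
  value≤objective x (0≤x , K≤Σx , Σpx≤m) = begin
    (+ s) / suc t * v
      ≡⟨ scale ⟩
    1/t * sumFin s (λ _ → v)
      ≤⟨ *-monoˡ-≤-nonNeg 1/t {{normalize-nonNeg 1 (suc t)}}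
           (sumFin-mono-≤ s (λ i → rowValue≤rowCost s σ' K (0≤x i , K≤Σx i , Σpx≤m i))) ⟩
    objective (suc t) s (suc σ') x  ∎
    where open ≤-Reasoning

-- For a positive numerator the two cases are those of the integer division in ⌊− p⌋.
ceiling-ℕ : ∀ p .{{_ : NonNegative p}} → ∃ λ k → ceiling p ≡ + k
ceiling-ℕ (mkℚ (+ zero) d _) = _ , refl
ceiling-ℕ (mkℚ (+ suc a) d _) with suc a ℕ.% suc d
... | zero  = _ , trans (cong ℤ.-_ (ℤ.*-identityˡ _)) (ℤ.neg-involutive _)
... | suc _ = _ , refl

ceilCγ-ℕ : ∀ c γ .{{_ : NonZero γ}} → ∃ λ k → ceilCγ c γ ≡ ℕtoℚ k
ceilCγ-ℕ c γ with k , ⌈c/γ⌉≡k ← ceiling-ℕ ((+ c) / γ) {{normalize-nonNeg c γ}} = k , cong (_/ 1) ⌈c/γ⌉≡k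

proposition2p3 : (t s c σ γ : ℕ) → .{{_ : NonZero t}} → .{{_ : NonZero s}} → .{{_ : NonZero c}} → .{{_ : NonZero σ}} → .{{_ : NonZero γ}} → IsOptimalValue t s c σ γ (optValue t s c σ γ)
proposition2p3 (suc t) s c (suc σ') γ with k , K≡k ← ceilCγ-ℕ c γ =
  subst (λ K → IsLPOptimum (suc t) s (suc σ') K ((+ s) / suc t * rowValue s σ' K))
        (sym K≡k) (lpOptimum t s σ' k)
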